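{- Every Galois polarity $(e_X,e_Y,R)$ is entangled, i.e.: (E1) for all $x_1,x_2\in X$ with $x_1\not\le_X x_2$ there is $y\in Y$ with $x_2\mathrel{R}y$ and not $x_1\mathrel{R}y$; and (E2) for all $y_1,y_2\in Y$ with $y_1\not\le_Y y_2$ there is $x\in X$ with $x\mathrel{R}y_1$ and not $x\mathrel{R}y_2$.
   Context: For a poset $Q$, $q^\uparrow=\{r:r\ge q\}$, $q^\downarrow=\{r:r\le q\}$. An order embedding $e:P\to Q$ is a meet-extension if $q=\bigwedge e[e^{ -1}(q^\uparrow)]$ for all $q\in Q$, and a join-extension if $q=\bigvee e[e^{ -1}(q^\downarrow)]$ for all $q\in Q$. An extension polarity is a triple $(e_X,e_Y,R)$ where $P$ is a poset, $X,Y$ disjoint posets, $e_X:P\to X$, $e_Y:P\to Y$ order embeddings, $R\subseteq X\times Y$. It is 3-coherent if: (C1) $x_1\le_X x_2$ and $x_2\mathrel{R}y$ imply $x_1\mathrel{R}y$; (C2) $y_1\le_Y y_2$ and $x\mathrel{R}y_1$ imply $x\mathrel{R}y_2$; (C3) $e_X(p)\mathrel{R}e_Y(p)$ for all $p\in P$; (C4) $x\mathrel{R}e_Y(p)$ and $e_X(p)\mathrel{R}y$ imply $x\mathrel{R}y$; (C5) $x_1\mathrel{R}e_Y(p)$ and $e_X(p)\le_X x_2$ imply $x_1\le_X x_2$; (C6) $y_1\le_Y e_Y(p)$ and $e_X(p)\mathrel{R}y_2$ imply $y_1\le_Y y_2$; (C7) if $S\subseteq P$, $\bigwedge e_X[S]=x$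 in $X$, $x\mathrel{R}y_2$ and $y_1\le_Y e_Y(p)$ for all $p\in S$, then $y_1\le_Y y_2$; (C8) if $T\subseteq P$, $\bigvee e_Y[T]=y$ in $Y$, $x_1\mathrel{R}y$ and $e_X(q)\le_X x_2$ for all $q\in T$, then $x_1\le_X x_2$. A Galois polarity is a 3-coherent extension polarity with $e_X$ a meet-extension and $e_Y$ a join-extension. -}

module Defs where

open import Level using (Level; suc)
open import Relation.Binary using (Poset; REL)
open import Relation.Unary using (Pred)
open import Relation.Nullary using (¬_)
open import Data.Product using (Σ; ∃; _×_; _,_)

module _ {a : Level} where

  IsOrderEmbedding : (P Q : Poset a a a) → (Poset.Carrier P → Poset.Carrier Q) → Set a
  IsOrderEmbedding P Q e =
    ∀ p q → (Poset._≤_ P p q → Poset._≤_ Q (e p) (e q))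
          × (Poset._≤_ Q (e p) (e q) → Poset._≤_ P p q)

  Img : (P Q : Poset a a a) → (Poset.Carrier P → Poset.Carrier Q)
      → Pred (Poset.Carrier P) a → Pred (Poset.Carrier Q) a
  Img P Q e S x = ∃ λ p → S p × Poset._≈_ Q x (e p)

  IsMeet : (Q : Poset a a a) → Pred (Poset.Carrier Q) a → Poset.Carrier Q → Set a
  IsMeet Q A x =
    (∀ z → A z → Poset._≤_ Q x z)
    × (∀ w → (∀ z → A z → Poset._≤_ Q w z) → Poset._≤_ Q w x)

  IsJoin : (Q : Poset a a a) → Pred (Poset.Carrier Q) a → Poset.Carrier Q → Set a
  IsJoin Q A x =
    (∀ z → A z → Poset._≤_ Q z x)
    × (∀ w → (∀ z → A z → Poset._≤_ Q z w) → Poset._≤_ Q x w)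

  IsMeetExtension : (P Q : Poset a a a) → (Poset.Carrier P → Poset.Carrier Q) → Set a
  IsMeetExtension P Q e =
    ∀ q → IsMeet Q (Img P Q e (λ p → Poset._≤_ Q q (e p))) q

  IsJoinExtension : (P Q : Poset a a a) → (Poset.Carrier P → Poset.Carrier Q) → Set a
  IsJoinExtension P Q e =
    ∀ q → IsJoin Q (Img P Q e (λ p → Poset._≤_ Q (e p) q)) q

  module _ (P X Y : Poset a a a)
           (eX : Poset.Carrier P → Poset.Carrier X)
           (eY : Poset.Carrier P → Poset.Carrier Y)
           (R : REL (Poset.Carrier X) (Poset.Carrier Y) a) where

    private
      _≤X_ = Poset._≤_ X
      _≤Y_ = Poset._≤_ Y

    record IsThreeCoherent : Set (suc a) where
      field
        C1 : ∀ x₁ x₂ y → x₁ ≤X x₂ → R x₂ y → R x₁ y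
        C2 : ∀ x y₁ y₂ → y₁ ≤Y y₂ → R x y₁ → R x y₂
        C3 : ∀ p → R (eX p) (eY p)
        C4 : ∀ x y p → R x (eY p) → R (eX p) y → R x y
        C5 : ∀ x₁ x₂ p → R x₁ (eY p) → eX p ≤X x₂ → x₁ ≤X x₂
        C6 : ∀ y₁ y₂ p → y₁ ≤Y eY p → R (eX p) y₂ → y₁ ≤Y y₂
        C7 : ∀ (S : Pred (Poset.Carrier P) a) x y₁ y₂
             → IsMeet X (Img P X eX S) x → R x y₂
             → (∀ p → S p → y₁ ≤Y eY p) → y₁ ≤Y y₂
        C8 : ∀ (T : Pred (Poset.Carrier P) a) y x₁ x₂
             → IsJoin Y (Img P Y eY T) y → R x₁ y
             → (∀ q → T q → eX q ≤X x₂) → x₁ ≤X x₂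

    record IsGaloisPolarity : Set (suc a) where
      field
        eX-embedding : IsOrderEmbedding P X eX
        eY-embedding : IsOrderEmbedding P Y eY
        coherent     : IsThreeCoherent
        eX-meetExt   : IsMeetExtension P X eX
        eY-joinExt   : IsJoinExtension P Y eY

  IsEntangled : (X Y : Poset a a a) → REL (Poset.Carrier X) (Poset.Carrier Y) a → Set a
  IsEntangled X Y R =
    (∀ x₁ x₂ → ¬ Poset._≤_ X x₁ x₂ → ∃ λ y → R x₂ y × ¬ R x₁ y)
    × (∀ y₁ y₂ → ¬ Poset._≤_ Y y₁ y₂ → ∃ λ x → R x y₁ × ¬ R x y₂)

-- Classically, x₁ ≰ x₂ is witnessed by the image of some p above x₂ but not above x₁:
-- otherwise x₁ is a lower bound of e[e⁻¹(x₂↑)], whose meet is x₂.  Every R-relation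
-- needed then comes from C3 at that p, moved along the order by C1/C5 (resp. C2/C6).

module Submission where

open import Defs
open import Level using (Level)
open import Relation.Binary using (Poset; REL)
open import Axiom.ExcludedMiddle using (ExcludedMiddle)
open import Axiom.DoubleNegationElimination using (em⇒dne)
open import Data.Product using (∃; _×_; _,_; proj₂)
open import Relation.Nullary using (¬_)
import Relation.Binary.Properties.Poset as PosetProperties

module _ {a : Level} (em : ExcludedMiddle a) where

  meetExtension-separates : (P Q : Poset a a a) {e : Poset.Carrier P → Poset.Carrier Q}
    → IsMeetExtension P Q e
    → ∀ q₁ q₂ → ¬ Poset._≤_ Q q₁ q₂
    → ∃ λ p → Poset._≤_ Q q₂ (e p) × ¬ Poset._≤_ Q q₁ (e p)
  meetExtension-separates P Q {e} meetExt q₁ q₂ q₁≰q₂ =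
    em⇒dne em λ noSeparator → q₁≰q₂ (proj₂ (meetExt q₂) q₁ (lowerBound noSeparator))
    where
    open Poset Q
    lowerBound : ¬ (∃ λ p → q₂ ≤ e p × ¬ q₁ ≤ e p)
               → ∀ z → Img P Q e (λ p → q₂ ≤ e p) z → q₁ ≤ z
    lowerBound noSeparator z (p , q₂≤ep , z≈ep) =
      ≤-respʳ-≈ (Eq.sym z≈ep) (em⇒dne em λ q₁≰ep → noSeparator (p , q₂≤ep , q₁≰ep))

  joinExtension-separates : (P Q : Poset a a a) {e : Poset.Carrier P → Poset.Carrier Q}
    → IsJoinExtension P Q e
    → ∀ q₁ q₂ → ¬ Poset._≤_ Q q₁ q₂
    → ∃ λ p → Poset._≤_ Q (e p) q₁ × ¬ Poset._≤_ Q (e p) q₂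
  -- a join-extension into Q is, definitionally, a meet-extension into Q ordered by ≥
  joinExtension-separates P Q joinExt q₁ q₂ q₁≰q₂ =
    meetExtension-separates P (PosetProperties.≥-poset Q) joinExt q₂ q₁ q₁≰q₂

  module _ {P X Y : Poset a a a}
           {eX : Poset.Carrier P → Poset.Carrier X}
           {eY : Poset.Carrier P → Poset.Carrier Y}
           {R : REL (Poset.Carrier X) (Poset.Carrier Y) a}
           (coherent : IsThreeCoherent P X Y eX eY R) where

    open IsThreeCoherent coherent
    private
      module X = Poset X
      module Y = Poset Y

    meetExtension⇒entangledˣ : IsMeetExtension P X eX
      → ∀ x₁ x₂ → ¬ x₁ X.≤ x₂ → ∃ λ y → R x₂ y × ¬ R x₁ y
    meetExtension⇒entangledˣ meetExt x₁ x₂ x₁≰x₂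
      with meetExtension-separates P X meetExt x₁ x₂ x₁≰x₂
    ... | p , x₂≤eXp , x₁≰eXp =
      eY p , C1 x₂ (eX p) (eY p) x₂≤eXp (C3 p)
           , λ x₁ReYp → x₁≰eXp (C5 x₁ (eX p) p x₁ReYp X.refl)

    joinExtension⇒entangledʸ : IsJoinExtension P Y eY
      → ∀ y₁ y₂ → ¬ y₁ Y.≤ y₂ → ∃ λ x → R x y₁ × ¬ R x y₂
    joinExtension⇒entangledʸ joinExt y₁ y₂ y₁≰y₂
      with joinExtension-separates P Y joinExt y₁ y₂ y₁≰y₂
    ... | p , eYp≤y₁ , eYp≰y₂ =
      eX p , C2 (eX p) (eY p) y₁ eYp≤y₁ (C3 p)
           , λ eXpRy₂ → eYp≰y₂ (C6 (eY p) y₂ p Y.refl eXpRy₂)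

lemma4p7 : {a : Level} → ExcludedMiddle a
         → (P X Y : Poset a a a)
         → (eX : Poset.Carrier P → Poset.Carrier X)
         → (eY : Poset.Carrier P → Poset.Carrier Y)
         → (R : REL (Poset.Carrier X) (Poset.Carrier Y) a)
         → IsGaloisPolarity P X Y eX eY R
         → IsEntangled X Y R
lemma4p7 em P X Y eX eY R galois =
    meetExtension⇒entangledˣ em coherent eX-meetExt
  , joinExtension⇒entangledʸ em coherent eY-joinExt
  where open IsGaloisPolarity galois
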